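{- Let $d\ge2$ and let $(A_{m,n})_{m\ge1,n\in\mathbb Z}$ be the bi-infinite $d$-Ostrowski array. Then every nonzero integer $N$ occurs exactly once among the entries $A_{m,n}$ with $m\ge1$ and $n\le -|w_m|$ (the entries to the left of the red wall), where $|w_m|$ is the length of the word $w_m$.
   Context: Define $(D_n)$ by $D_0=0$, $D_1=1$, $D_{n+1}=dD_n+D_{n-1}$. An Ostrowski word is a finite word $d_1\cdots d_i$ over $\{0,\dots,d\}$ with $0\le d_1<d$, $0\le d_j\le d$ for $j>1$, and $d_{j-1}=0$ whenever $d_j=d$; it represents $\sum_j d_jD_j$. Every non-negative integer has a unique Ostrowski word with nonzero last digit. An Ostrowski word is trimmed if its last digit is nonzero and it cannot be written as $0v$ with $v$ an Ostrowski word (equivalently, its first digit is nonzero, or its first two digits are $0$ and $d$). Let $w_1,w_2,\dots$ be the trimmed Ostrowski words listed in increasing order of the integers they represent. For $m,n\ge1$ let $A_{m,n}$ be the integer represented by $0^{n-1}w_m$; each row satisfies $A_{m,n+1}=dA_{m,n}+A_{m,n-1}$, and the rows are extended to all $n\in\mathbb Z$ by this recurrence. The red wall term of row $m$ is $A_{m,r}$ with $r=1-|w_m|$, so the entries to the left of the red wall in row $m$ are $A_{m,n}$ with $n\le r-1=-|w_m|$. -}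

module Defs where

open import Data.Nat using (ℕ; zero; suc; _+_; _*_; _≤_; _<_)
open import Data.Integer as ℤ using (ℤ; +_; -[1+_])
open import Data.List using (List; []; _∷_; _++_; replicate; length)
open import Data.List.Relation.Unary.All using (All)
open import Data.List.Relation.Unary.Unique.Propositional using (Unique)
open import Data.List.Membership.Propositional using (_∈_)
open import Data.Product using (Σ; _×_; _,_; proj₁)
open import Relation.Binary.PropositionalEquality using (_≡_; _≢_)
open import Relation.Nullary using (¬_)

D : ℕ → ℕ → ℕ
D d zero = 0
D d (suc zero) = 1
D d (suc (suc n)) = d * D d (suc n) + D d n

-- Words d_1 d_2 ... d_i are lists, head = d_1.
Word : Set
Word = List ℕ

data OstrTail (d : ℕ) : ℕ → Word → Set where
  []  : ∀ {p} → OstrTail d p []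
  _∷_ : ∀ {p y ys} → (y ≤ d) × (y ≡ d → p ≡ 0) → OstrTail d y ys → OstrTail d p (y ∷ ys)

data Ostrowski (d : ℕ) : Word → Set where
  []  : Ostrowski d []
  _∷_ : ∀ {x xs} → x < d → OstrTail d x xs → Ostrowski d (x ∷ xs)

data LastNonzero : Word → Set where
  single : ∀ {x} → x ≢ 0 → LastNonzero (x ∷ [])
  cons   : ∀ {x y ys} → LastNonzero (y ∷ ys) → LastNonzero (x ∷ y ∷ ys)

valFrom : ℕ → ℕ → Word → ℕ
valFrom d k [] = 0
valFrom d k (x ∷ xs) = x * D d k + valFrom d (suc k) xs

val : ℕ → Word → ℕ
val d = valFrom d 1

Trimmed : ℕ → Word → Set
Trimmed d w = Ostrowski d w × LastNonzero w
            × (∀ v → w ≡ 0 ∷ v → ¬ Ostrowski d v)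

-- IsW d m w : w is w_m, the m-th (m ≥ 1) trimmed word in increasing order of value,
-- i.e. w is trimmed and exactly m - 1 (distinct) trimmed words have smaller value.
IsW : ℕ → ℕ → Word → Set
IsW d m w = (1 ≤ m) × Trimmed d w ×
  Σ (List Word) λ L → Unique L
    × All (λ v → Trimmed d v × val d v < val d w) L
    × (∀ v → Trimmed d v → val d v < val d w → v ∈ L)
    × suc (length L) ≡ m

-- Row of the array for the word w:  A(n) = value of 0^{n-1} w for n ≥ 1,
-- extended to n ≤ 0 by A(n-1) = A(n+1) - d A(n).
rowPos : ℕ → Word → ℕ → ℤ
rowPos d w k = + val d (replicate k 0 ++ w)     -- this is A(k+1)

-- back k = (A(1-k), A(2-k))
back : ℕ → Word → ℕ → ℤ × ℤ
back d w zero = rowPos d w 0 , rowPos d w 1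
back d w (suc k) with back d w k
... | x , y = y ℤ.- (+ d) ℤ.* x , x

A : ℕ → Word → ℤ → ℤ
A d w (+ suc k) = rowPos d w k
A d w (+ zero)  = proj₁ (back d w 1)
A d w -[1+ k ]  = proj₁ (back d w (suc (suc k)))

module Submission where

-- The entry A(−K) of the row of w, for K ≥ |w|, is (−1)^{K+1} times the alternating value
-- H_K(p) = p₁D_K − p₂D_{K−1} + ⋯ ± p_K D₁ of p = w0^{K−|w|}. On the Ostrowski words of
-- length K, H_K is a bijection onto D_{K+1} consecutive integers (induction on K, splitting
-- off a leading pair 0d or a leading digit x < d). Prepending 0 carries a
-- representation of N at K to one at K + 1, and the windows grow past |N|, so N is
-- represented exactly from some least K on. There, stripping trailing zeros from the
-- representing word gives a trimmed w with A_w(−K) = N, and minimality is exactly what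
-- makes it trimmed; conversely, any trimmed solution at a K′ > K would, by injectivity,
-- start with 0 followed by an Ostrowski word. The row index m of w is its rank.

open import Defs
open import Data.Nat using (ℕ; zero; suc; _+_; _*_; _∸_; _≤_; _<_; _≤′_; ≤′-refl; ≤′-step; z≤n; s≤s; pred; NonZero)
open import Data.Nat.Base using (>-nonZero; ≢-nonZero)
import Data.Nat.Properties as ℕP
open import Data.Nat.DivMod using (_/_; _%_; m≡m%n+[m/n]*n; m%n<n; m<n*o⇒m/o<n; [m+kn]%n≡m%n; m<n⇒m%n≡m)
import Data.Nat.Tactic.RingSolver as ℕRing
open import Data.Integer as ℤ using (ℤ; +_; -_; -[1+_]; ∣_∣; +≤+; -≤-) renaming (_+_ to _+ᶻ_; _-_ to _-ᶻ_; _*_ to _*ᶻ_; _≤_ to _≤ℤ_)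
import Data.Integer.Properties as ℤP
open import Algebra.Properties.AbelianGroup ℤP.+-0-abelianGroup using (∙-cancelˡ; ∙-cancelʳ)
open import Data.Integer.Tactic.RingSolver using (solve-∀)
open import Data.List using (List; []; _∷_; _++_; replicate; length; upTo; cartesianProductWith; concatMap; filter; deduplicate)
import Data.List.Properties as ListP
open import Data.List.Membership.Propositional using (_∈_; lose)
open import Data.List.Membership.Propositional.Properties using (∈-upTo⁺; ∈-cartesianProductWith⁺; ∈-concatMap⁺; ∈-filter⁺; ∈-filter⁻; ∈-deduplicate⁺; ∈-deduplicate⁻)
open import Data.List.Membership.Propositional.Properties.WithK using (unique∧set⇒bag)
open import Data.List.Relation.Unary.All as All using (All; []; _∷_)
open import Data.List.Relation.Unary.Any using (here)
open import Data.List.Relation.Unary.Unique.Propositional using (Unique)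
import Data.List.Relation.Unary.Unique.DecPropositional.Properties as UniqueP
open import Data.List.Relation.Binary.BagAndSetEquality using (∼bag⇒↭)
open import Data.List.Relation.Binary.Permutation.Propositional.Properties using (↭-length)
open import Data.Product using (Σ; _×_; _,_; proj₁; proj₂)
open import Data.Empty using (⊥-elim)
open import Function.Bundles using (mk⇔)
open import Relation.Binary.PropositionalEquality using (_≡_; _≢_; refl; sym; trans; cong; cong₂; subst; subst₂; module ≡-Reasoning)
open import Relation.Nullary using (¬_; Dec; yes; no)
open import Relation.Nullary.Decidable using (_×-dec_; map′)

quotient-remainder-unique : ∀ {n q q′ r r′} → r < n → r′ < n →
                            r + q * n ≡ r′ + q′ * n → q ≡ q′ × r ≡ r′
quotient-remainder-unique {n} {q} {q′} {r} {r′} r<n r′<n eq = quotient , remainder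
  where
  instance
    n-nonZero : NonZero n
    n-nonZero = >-nonZero (ℕP.<-≤-trans (s≤s z≤n) r<n)
  remainder : r ≡ r′
  remainder = begin
    r                   ≡⟨ sym (m<n⇒m%n≡m r<n) ⟩
    r % n               ≡⟨ sym ([m+kn]%n≡m%n r q n) ⟩
    (r + q * n) % n     ≡⟨ cong (_% n) eq ⟩
    (r′ + q′ * n) % n   ≡⟨ [m+kn]%n≡m%n r′ q′ n ⟩
    r′ % n              ≡⟨ m<n⇒m%n≡m r′<n ⟩
    r′                  ∎
    where open ≡-Reasoning
  quotient : q ≡ q′
  quotient = ℕP.*-cancelʳ-≡ q q′ n (ℕP.+-cancelˡ-≡ r _ _ (trans eq (cong (_+ q′ * n) (sym remainder))))

r+q*n<d*n : ∀ {d n q r} → q < d → r < n → r + q * n < d * n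
r+q*n<d*n {d} {n} {q} {r} q<d r<n = ℕP.≤-trans (ℕP.+-monoˡ-< (q * n) r<n) (ℕP.*-monoˡ-≤ n q<d)

complement : ∀ {t n} → t < n → Σ ℕ λ r → r < n × t + suc r ≡ n
complement {t} {n} t<n = n ∸ suc t , subst (suc (n ∸ suc t) ≤_) split (ℕP.m≤n+m _ t) , split
  where
  split : t + suc (n ∸ suc t) ≡ n
  split = trans (ℕP.+-suc t _) (ℕP.m+[n∸m]≡n t<n)

a+i-a≡i : ∀ a i → a +ᶻ i -ᶻ a ≡ i
a+i-a≡i = solve-∀

a+[i-a]≡i : ∀ a i → a +ᶻ (i -ᶻ a) ≡ i
a+[i-a]≡i = solve-∀

ε : ℕ → ℤ
ε zero    = + 1
ε (suc k) = - ε k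

ε²≡1 : ∀ k → ε k *ᶻ ε k ≡ + 1
ε²≡1 zero = refl
ε²≡1 (suc k) = trans (identity (ε k)) (ε²≡1 k)
  where
  identity : ∀ s → (- s) *ᶻ (- s) ≡ s *ᶻ s
  identity = solve-∀

∣ε*i∣≡∣i∣ : ∀ k i → ∣ ε k *ᶻ i ∣ ≡ ∣ i ∣
∣ε*i∣≡∣i∣ zero i = cong ∣_∣ (ℤP.*-identityˡ i)
∣ε*i∣≡∣i∣ (suc k) i = trans (cong ∣_∣ (identity (ε k) i)) (trans (∣ε*i∣≡∣i∣ k (- i)) (ℤP.∣-i∣≡∣i∣ i))
  where
  identity : ∀ s i → (- s) *ᶻ i ≡ s *ᶻ (- i)
  identity = solve-∀

s*[g-e]≡n⇒g≡s*n+e : ∀ {s g e n} → s *ᶻ s ≡ + 1 → s *ᶻ (g -ᶻ e) ≡ n → g ≡ s *ᶻ n +ᶻ e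
s*[g-e]≡n⇒g≡s*n+e {s} {g} {e} {n} s²≡1 eq = begin
  g                              ≡⟨ identity₁ g e ⟩
  + 1 *ᶻ (g -ᶻ e) +ᶻ e           ≡⟨ cong (λ u → u *ᶻ (g -ᶻ e) +ᶻ e) (sym s²≡1) ⟩
  s *ᶻ s *ᶻ (g -ᶻ e) +ᶻ e        ≡⟨ identity₂ s (g -ᶻ e) e ⟩
  s *ᶻ (s *ᶻ (g -ᶻ e)) +ᶻ e      ≡⟨ cong (λ u → s *ᶻ u +ᶻ e) eq ⟩
  s *ᶻ n +ᶻ e                    ∎
  where
  open ≡-Reasoning
  identity₁ : ∀ g e → g ≡ + 1 *ᶻ (g -ᶻ e) +ᶻ e
  identity₁ = solve-∀
  identity₂ : ∀ s h e → s *ᶻ s *ᶻ h +ᶻ e ≡ s *ᶻ (s *ᶻ h) +ᶻ e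
  identity₂ = solve-∀

g≡s*n+e⇒s*[g-e]≡n : ∀ {s g e n} → s *ᶻ s ≡ + 1 → g ≡ s *ᶻ n +ᶻ e → s *ᶻ (g -ᶻ e) ≡ n
g≡s*n+e⇒s*[g-e]≡n {s} {g} {e} {n} s²≡1 refl = begin
  s *ᶻ (s *ᶻ n +ᶻ e -ᶻ e)   ≡⟨ identity s n e ⟩
  s *ᶻ s *ᶻ n               ≡⟨ cong (_*ᶻ n) s²≡1 ⟩
  + 1 *ᶻ n                  ≡⟨ ℤP.*-identityˡ n ⟩
  n                         ∎
  where
  open ≡-Reasoning
  identity : ∀ s n e → s *ᶻ (s *ᶻ n +ᶻ e -ᶻ e) ≡ s *ᶻ s *ᶻ n
  identity = solve-∀

[even] : ℕ → ℤ
[even] zero = + 1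
[even] (suc K) = + 1 -ᶻ [even] K

[even]-bit : ∀ K → Σ ℕ λ b → b ≤ 1 × [even] K ≡ + b
[even]-bit zero = 1 , ℕP.≤-refl , refl
[even]-bit (suc K) with [even]-bit K
... | 0 , _ , eq = 1 , ℕP.≤-refl , cong (+ 1 -ᶻ_) eq
... | 1 , _ , eq = 0 , z≤n , cong (+ 1 -ᶻ_) eq
... | suc (suc _) , s≤s () , _

∣i∣<u⇒i≡1-u+t : ∀ a u → ∣ a ∣ < u → Σ ℕ λ t → suc t < 2 * u × a ≡ + 1 -ᶻ + u +ᶻ + t
∣i∣<u⇒i≡1-u+t (+ n) (suc u) (s≤s n≤u) = n + u , bound , a≡
  where
  bound : suc (n + u) < 2 * suc u
  bound = subst (suc (suc (n + u)) ≤_) (identity u) (s≤s (s≤s (ℕP.+-monoˡ-≤ u n≤u)))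
    where
    identity : ∀ u → 2 + (u + u) ≡ 2 * suc u
    identity = ℕRing.solve-∀
  a≡ : + n ≡ + 1 -ᶻ + suc u +ᶻ + (n + u)
  a≡ = trans (identity (+ n) (+ u)) (cong₂ (λ v s → + 1 -ᶻ v +ᶻ s) (sym (ℤP.pos-+ 1 u)) (sym (ℤP.pos-+ n u)))
    where
    identity : ∀ n u → n ≡ + 1 -ᶻ (+ 1 +ᶻ u) +ᶻ (n +ᶻ u)
    identity = solve-∀
∣i∣<u⇒i≡1-u+t -[1+ n ] u n<u with u ∸ suc (suc n) | ℕP.m+[n∸m]≡n n<u
... | k | refl = k , ℕP.<-≤-trans (s≤s (s≤s (ℕP.m≤n+m k n))) (ℕP.m≤m+n _ _) , a≡
  where
  a≡ : -[1+ n ] ≡ + 1 -ᶻ + (suc (suc n) + k) +ᶻ + k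
  a≡ = trans (cong -_ (ℤP.pos-+ 1 n))
             (trans (identity (+ n) (+ k))
                    (cong (λ v → + 1 -ᶻ v +ᶻ + k) (sym (trans (ℤP.pos-+ (2 + n) k) (cong (_+ᶻ + k) (ℤP.pos-+ 2 n))))))
    where
    identity : ∀ n k → - (+ 1 +ᶻ n) ≡ + 1 -ᶻ (+ 2 +ᶻ n +ᶻ k) +ᶻ k
    identity = solve-∀

≤-[-k]⇒≡-[K] : ∀ n k → n ≤ℤ - (+ k) → Σ ℕ λ K → k ≤ K × n ≡ - (+ K)
≤-[-k]⇒≡-[K] (+ zero) zero _ = 0 , z≤n , refl
≤-[-k]⇒≡-[K] (+ suc n) zero (+≤+ ())
≤-[-k]⇒≡-[K] -[1+ j ] zero _ = suc j , z≤n , refl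
≤-[-k]⇒≡-[K] -[1+ j ] (suc k) (-≤- k≤j) = suc j , s≤s k≤j , refl

lastNonzero? : ∀ w → Dec (LastNonzero w)
lastNonzero? [] = no λ ()
lastNonzero? (x ∷ []) with x ℕP.≟ 0
... | yes x≡0 = no λ { (single x≢0) → x≢0 x≡0 }
... | no x≢0 = yes (single x≢0)
lastNonzero? (x ∷ y ∷ w) with lastNonzero? (y ∷ w)
... | yes l = yes (cons l)
... | no ¬l = no λ { (cons l) → ¬l l }

lastNonzero-∷ : ∀ {x w} → LastNonzero w → LastNonzero (x ∷ w)
lastNonzero-∷ l@(single _) = cons l
lastNonzero-∷ l@(cons _) = cons l

data TrailingZeros : Word → Set where
  zeros    : ∀ j → TrailingZeros (replicate j 0)
  nonzeros : ∀ {w} → LastNonzero w → ∀ j → TrailingZeros (w ++ replicate j 0)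

trailingZeros : ∀ p → TrailingZeros p
trailingZeros [] = zeros 0
trailingZeros (x ∷ p) with trailingZeros p | x ℕP.≟ 0
... | nonzeros l j | _       = nonzeros (lastNonzero-∷ l) j
... | zeros j      | yes refl = zeros (suc j)
... | zeros j      | no x≢0  = nonzeros (single x≢0) j

lastNonzero-++≢zeros : ∀ {u} v a → LastNonzero u → u ++ v ≢ replicate a 0
lastNonzero-++≢zeros v (suc a) (single x≢0) eq = x≢0 (ListP.∷-injectiveˡ eq)
lastNonzero-++≢zeros v (suc a) (cons l) eq = lastNonzero-++≢zeros v a l (ListP.∷-injectiveʳ eq)

++-zeros-injective : ∀ {w w′} a b → LastNonzero w → LastNonzero w′ →
                     w ++ replicate a 0 ≡ w′ ++ replicate b 0 → w ≡ w′
++-zeros-injective a b (single _) (single _) eq = cong (_∷ []) (ListP.∷-injectiveˡ eq)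
++-zeros-injective a b (single _) (cons l′) eq =
  ⊥-elim (lastNonzero-++≢zeros (replicate b 0) a l′ (sym (ListP.∷-injectiveʳ eq)))
++-zeros-injective a b (cons l) (single _) eq =
  ⊥-elim (lastNonzero-++≢zeros (replicate a 0) b l (ListP.∷-injectiveʳ eq))
++-zeros-injective a b (cons l) (cons l′) eq =
  cong₂ _∷_ (ListP.∷-injectiveˡ eq) (++-zeros-injective a b l l′ (ListP.∷-injectiveʳ eq))

wordsOfLength : ℕ → ℕ → List Word
wordsOfLength b zero = [] ∷ []
wordsOfLength b (suc n) = cartesianProductWith _∷_ (upTo b) (wordsOfLength b n)

∈-wordsOfLength : ∀ {b w} → All (_< b) w → w ∈ wordsOfLength b (length w)
∈-wordsOfLength [] = here refl
∈-wordsOfLength (x<b ∷ w<b) = ∈-cartesianProductWith⁺ _∷_ (∈-upTo⁺ x<b) (∈-wordsOfLength w<b)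

wordsUpTo : ℕ → ℕ → List Word
wordsUpTo b n = concatMap (wordsOfLength b) (upTo (suc n))

∈-wordsUpTo : ∀ {b n w} → All (_< b) w → length w ≤ n → w ∈ wordsUpTo b n
∈-wordsUpTo {b} w<b len≤n = ∈-concatMap⁺ (wordsOfLength b) (lose (∈-upTo⁺ (s≤s len≤n)) (∈-wordsOfLength w<b))

module _ {d : ℕ} where

  ostrTail? : ∀ p w → Dec (OstrTail d p w)
  ostrTail? p [] = yes []
  ostrTail? p (y ∷ w) with y ℕP.≤? d | y ℕP.≟ d | p ℕP.≟ 0 | ostrTail? y w
  ... | no y≰d | _       | _       | _      = no λ { ((y≤d , _) ∷ _) → y≰d y≤d }
  ... | yes _  | _       | _       | no ¬t  = no λ { (_ ∷ t) → ¬t t }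
  ... | yes _  | yes y≡d | no p≢0  | yes _  = no λ { ((_ , y≡d⇒p≡0) ∷ _) → p≢0 (y≡d⇒p≡0 y≡d) }
  ... | yes y≤d | yes _  | yes p≡0 | yes t  = yes ((y≤d , λ _ → p≡0) ∷ t)
  ... | yes y≤d | no y≢d | _       | yes t  = yes ((y≤d , λ y≡d → ⊥-elim (y≢d y≡d)) ∷ t)

  ostrowski? : ∀ w → Dec (Ostrowski d w)
  ostrowski? [] = yes []
  ostrowski? (x ∷ w) with x ℕP.<? d | ostrTail? x w
  ... | yes x<d | yes t = yes (x<d ∷ t)
  ... | no x≮d  | _     = no λ { (x<d ∷ _) → x≮d x<d }
  ... | yes _   | no ¬t = no λ { (_ ∷ t) → ¬t t }

  not-0∷ostrowski? : ∀ w → Dec (∀ v → w ≡ 0 ∷ v → ¬ Ostrowski d v)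
  not-0∷ostrowski? [] = yes λ _ ()
  not-0∷ostrowski? (suc x ∷ w) = yes λ _ ()
  not-0∷ostrowski? (zero ∷ w) with ostrowski? w
  ... | yes ow = no λ not-0∷ → not-0∷ w refl ow
  ... | no ¬ow = yes λ { _ refl ow → ¬ow ow }

  trimmed? : ∀ w → Dec (Trimmed d w)
  trimmed? w = ostrowski? w ×-dec lastNonzero? w ×-dec not-0∷ostrowski? w

  ostrTail-digits : ∀ {p w} → OstrTail d p w → All (_< suc d) w
  ostrTail-digits [] = []
  ostrTail-digits ((y≤d , _) ∷ t) = s≤s y≤d ∷ ostrTail-digits t

  ostrowski-digits : ∀ {w} → Ostrowski d w → All (_< suc d) w
  ostrowski-digits [] = []
  ostrowski-digits (x<d ∷ t) = ℕP.m≤n⇒m≤1+n x<d ∷ ostrTail-digits t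

  rank-unique : ∀ {m m′ w} → IsW d m w → IsW d m′ w → m ≡ m′
  rank-unique {w = w} (_ , _ , L , uL , belowL , completeL , refl) (_ , _ , L′ , uL′ , belowL′ , completeL′ , refl) =
    cong suc (↭-length (∼bag⇒↭ (unique∧set⇒bag uL uL′ (mk⇔ (⊆ belowL completeL′) (⊆ belowL′ completeL)))))
    where
    ⊆ : ∀ {M M′} → All (λ v → Trimmed d v × val d v < val d w) M →
        (∀ v → Trimmed d v → val d v < val d w → v ∈ M′) → ∀ {v} → v ∈ M → v ∈ M′
    ⊆ belowM completeM′ v∈M = completeM′ _ (proj₁ (All.lookup belowM v∈M)) (proj₂ (All.lookup belowM v∈M))

module _ {d : ℕ} (0<d : 0 < d) where

  d≢0 : d ≢ 0
  d≢0 d≡0 = ℕP.<-irrefl (sym d≡0) 0<d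

  ostrTail⇒ostrowski : ∀ {p w} → OstrTail d p w → p ≢ 0 → Ostrowski d w
  ostrTail⇒ostrowski [] _ = []
  ostrTail⇒ostrowski ((y≤d , y≡d⇒p≡0) ∷ t) p≢0 = ℕP.≤∧≢⇒< y≤d (λ y≡d → p≢0 (y≡d⇒p≡0 y≡d)) ∷ t

  ostrowski⇒ostrTail : ∀ {p w} → Ostrowski d w → OstrTail d p w
  ostrowski⇒ostrTail [] = []
  ostrowski⇒ostrTail (y<d ∷ t) = (ℕP.<⇒≤ y<d , λ y≡d → ⊥-elim (ℕP.<-irrefl y≡d y<d)) ∷ t

  0∷-ostrowski : ∀ {w} → Ostrowski d w → Ostrowski d (0 ∷ w)
  0∷-ostrowski o = 0<d ∷ ostrowski⇒ostrTail o

  0∷d∷-ostrowski : ∀ {w} → Ostrowski d w → Ostrowski d (0 ∷ d ∷ w)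
  0∷d∷-ostrowski o = 0<d ∷ ((ℕP.≤-refl , λ _ → refl) ∷ ostrowski⇒ostrTail o)

  ostrTail-++⁻ˡ : ∀ {p} w {v} → OstrTail d p (w ++ v) → OstrTail d p w
  ostrTail-++⁻ˡ [] _ = []
  ostrTail-++⁻ˡ (y ∷ w) (c ∷ t) = c ∷ ostrTail-++⁻ˡ w t

  ostrowski-++⁻ˡ : ∀ w {v} → Ostrowski d (w ++ v) → Ostrowski d w
  ostrowski-++⁻ˡ [] _ = []
  ostrowski-++⁻ˡ (x ∷ w) (x<d ∷ t) = x<d ∷ ostrTail-++⁻ˡ w t

  ostrTail-zeros : ∀ {p} j → OstrTail d p (replicate j 0)
  ostrTail-zeros zero = []
  ostrTail-zeros (suc j) = (z≤n , λ 0≡d → ⊥-elim (d≢0 (sym 0≡d))) ∷ ostrTail-zeros j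

  ostrTail-++-zeros : ∀ {p w} j → OstrTail d p w → OstrTail d p (w ++ replicate j 0)
  ostrTail-++-zeros j [] = ostrTail-zeros j
  ostrTail-++-zeros j (c ∷ t) = c ∷ ostrTail-++-zeros j t

  ostrowski-++-zeros : ∀ {w} j → Ostrowski d w → Ostrowski d (w ++ replicate j 0)
  ostrowski-++-zeros zero [] = []
  ostrowski-++-zeros (suc j) [] = 0<d ∷ ostrTail-zeros j
  ostrowski-++-zeros j (x<d ∷ t) = x<d ∷ ostrTail-++-zeros j t

  data LeadingDigits (L : ℕ) : Word → Set where
    digit  : ∀ {x w} → x < d → Ostrowski d w → length w ≡ L → LeadingDigits L (x ∷ w)
    zero-d : ∀ {w} → Ostrowski d w → suc (length w) ≡ L → LeadingDigits L (0 ∷ d ∷ w)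

  leadingDigits : ∀ {L} p → Ostrowski d p → length p ≡ suc L → LeadingDigits L p
  leadingDigits (x ∷ []) (x<d ∷ _) len = digit x<d [] (ℕP.suc-injective len)
  leadingDigits (x ∷ y ∷ w) (x<d ∷ ((y≤d , y≡d⇒x≡0) ∷ t)) len with y ℕP.≟ d
  ... | no y≢d = digit x<d (ℕP.≤∧≢⇒< y≤d y≢d ∷ t) (ℕP.suc-injective len)
  ... | yes refl with y≡d⇒x≡0 refl
  ... | refl = zero-d (ostrTail⇒ostrowski t d≢0) (ℕP.suc-injective len)

module _ {d : ℕ} (2≤d : 2 ≤ d) where

  D-double : ∀ k → 2 * D d (suc k) ≤ D d (2 + k)
  D-double k = ℕP.≤-trans (ℕP.*-monoˡ-≤ (D d (suc k)) 2≤d) (ℕP.m≤m+n _ _)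

  n≤D : ∀ n → n ≤ D d n
  n≤D zero = z≤n
  n≤D (suc zero) = s≤s z≤n
  n≤D (suc (suc k)) = begin
    2 + k                       ≤⟨ s≤s (n≤D (suc k)) ⟩
    1 + D d (suc k)             ≤⟨ ℕP.+-monoˡ-≤ (D d (suc k)) (ℕP.≤-trans (s≤s z≤n) (n≤D (suc k))) ⟩
    D d (suc k) + D d (suc k)   ≡⟨ cong (λ z → D d (suc k) + z) (sym (ℕP.+-identityʳ _)) ⟩
    2 * D d (suc k)             ≤⟨ D-double k ⟩
    D d (2 + k)                 ∎
    where open ℕP.≤-Reasoning

  lastNonzero⇒D≤valFrom : ∀ k {w} → LastNonzero w → D d (length w + k) ≤ valFrom d (suc k) w
  lastNonzero⇒D≤valFrom k (single {x} x≢0) =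
    ℕP.≤-trans (ℕP.m≤m*n (D d (suc k)) x {{≢-nonZero x≢0}})
               (ℕP.≤-trans (ℕP.≤-reflexive (ℕP.*-comm (D d (suc k)) x)) (ℕP.m≤m+n _ 0))
  lastNonzero⇒D≤valFrom k (cons {x} {y} {w} l) = begin
    D d (suc (length (y ∷ w) + k)) ≡⟨ cong (D d) (sym (ℕP.+-suc (length (y ∷ w)) k)) ⟩
    D d (length (y ∷ w) + suc k)   ≤⟨ lastNonzero⇒D≤valFrom (suc k) l ⟩
    valFrom d (2 + k) (y ∷ w)      ≤⟨ ℕP.m≤n+m _ (x * D d (suc k)) ⟩
    valFrom d (suc k) (x ∷ y ∷ w)  ∎
    where open ℕP.≤-Reasoning

  length≤val : ∀ {w} → LastNonzero w → length w ≤ val d w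
  length≤val {w} l = ℕP.≤-trans (n≤D (length w))
                                (subst (λ n → D d n ≤ val d w) (ℕP.+-identityʳ (length w)) (lastNonzero⇒D≤valFrom 0 l))

  rank-exists : ∀ {w} → Trimmed d w → Σ ℕ λ m → IsW d m w
  rank-exists {w} tw = suc (length smaller) , s≤s z≤n , tw , smaller , unique , below , complete , refl
    where
    Below : Word → Set
    Below v = Trimmed d v × val d v < val d w
    below? : ∀ v → Dec (Below v)
    below? v = trimmed? v ×-dec (val d v ℕP.<? val d w)
    candidates : List Word
    candidates = filter below? (wordsUpTo (suc d) (val d w))
    smaller : List Word
    smaller = deduplicate (ListP.≡-dec ℕP._≟_) candidates
    unique : Unique smaller
    unique = UniqueP.deduplicate-! (ListP.≡-dec ℕP._≟_) candidates
    below : All Below smaller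
    below = All.tabulate λ v∈ →
      proj₂ (∈-filter⁻ below? {xs = wordsUpTo (suc d) (val d w)} (∈-deduplicate⁻ (ListP.≡-dec ℕP._≟_) candidates v∈))
    complete : ∀ v → Trimmed d v → val d v < val d w → v ∈ smaller
    complete v tv v<w = ∈-deduplicate⁺ (ListP.≡-dec ℕP._≟_) (∈-filter⁺ below?
      (∈-wordsUpTo (ostrowski-digits (proj₁ tv)) (ℕP.≤-trans (length≤val (proj₁ (proj₂ tv))) (ℕP.<⇒≤ v<w))) (tv , v<w))

module Windows (d : ℕ) where

  OfLength : ℕ → Word → Set
  OfLength K p = Ostrowski d p × length p ≡ K

  Dᶻ : ℕ → ℤ
  Dᶻ k = + D d k

  Dᶻ-rec : ∀ k → Dᶻ (2 + k) ≡ + d *ᶻ Dᶻ (suc k) +ᶻ Dᶻ k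
  Dᶻ-rec k = trans (ℤP.pos-+ (d * D d (suc k)) (D d k)) (cong (_+ᶻ Dᶻ k) (ℤP.pos-* d (D d (suc k))))

  -- For p of length K, G K p = H_K(p) + [K even] where H_K(p) = p₁D_K − p₂D_{K−1} + ⋯ ± p_K D₁
  -- is the alternating value of p; the shift makes the image of the length-K Ostrowski
  -- words the same window [1 − D_K, 1 − D_K + D_{K+1}) for every parity of K.
  G : ℕ → Word → ℤ
  G K []       = + 1
  G K (x ∷ ws) = + x *ᶻ Dᶻ K +ᶻ + 1 -ᶻ G (pred K) ws

  lo : ℕ → ℤ
  lo K = + 1 -ᶻ Dᶻ K

  InWindow : ℕ → ℤ → Set
  InWindow K z = Σ ℕ λ t → t < D d (suc K) × z ≡ lo K +ᶻ + t

  window-offset-injective : ∀ K {t u} → lo K +ᶻ + t ≡ lo K +ᶻ + u → t ≡ u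
  window-offset-injective K eq = ℤP.+-injective (∙-cancelˡ (lo K) _ _ eq)

  G-digit : ∀ K x w t r → t + suc r ≡ D d (2 + K) → G (suc K) w ≡ lo (suc K) +ᶻ + t →
            G (2 + K) (x ∷ w) ≡ lo (2 + K) +ᶻ + (D d (suc K) + (r + x * D d (2 + K)))
  G-digit K x w t r split eq = begin
      + x *ᶻ Dᶻ (2 + K) +ᶻ + 1 -ᶻ G (suc K) w
    ≡⟨ cong (λ g → + x *ᶻ Dᶻ (2 + K) +ᶻ + 1 -ᶻ g) eq ⟩
      + x *ᶻ Dᶻ (2 + K) +ᶻ + 1 -ᶻ (lo (suc K) +ᶻ + t)
    ≡⟨ subst (λ L → + x *ᶻ L +ᶻ + 1 -ᶻ (lo (suc K) +ᶻ + t) ≡ + 1 -ᶻ L +ᶻ (Dᶻ (suc K) +ᶻ (+ r +ᶻ + x *ᶻ L)))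
             (sym D≡t+1+r) (identity (+ x) (Dᶻ (suc K)) (+ t) (+ r)) ⟩
      lo (2 + K) +ᶻ (Dᶻ (suc K) +ᶻ (+ r +ᶻ + x *ᶻ Dᶻ (2 + K)))
    ≡⟨ cong (lo (2 + K) +ᶻ_) (sym cast) ⟩
      lo (2 + K) +ᶻ + (D d (suc K) + (r + x * D d (2 + K)))
    ∎
    where
    open ≡-Reasoning
    identity : ∀ x D₁ t r → x *ᶻ (t +ᶻ (+ 1 +ᶻ r)) +ᶻ + 1 -ᶻ (+ 1 -ᶻ D₁ +ᶻ t)
                           ≡ + 1 -ᶻ (t +ᶻ (+ 1 +ᶻ r)) +ᶻ (D₁ +ᶻ (r +ᶻ x *ᶻ (t +ᶻ (+ 1 +ᶻ r))))
    identity = solve-∀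
    D≡t+1+r : Dᶻ (2 + K) ≡ + t +ᶻ (+ 1 +ᶻ + r)
    D≡t+1+r = trans (cong +_ (sym split)) (trans (ℤP.pos-+ t (suc r)) (cong (+ t +ᶻ_) (ℤP.pos-+ 1 r)))
    cast : + (D d (suc K) + (r + x * D d (2 + K))) ≡ Dᶻ (suc K) +ᶻ (+ r +ᶻ + x *ᶻ Dᶻ (2 + K))
    cast = trans (ℤP.pos-+ (D d (suc K)) _)
                 (cong (Dᶻ (suc K) +ᶻ_) (trans (ℤP.pos-+ r _) (cong (+ r +ᶻ_) (ℤP.pos-* x (D d (2 + K))))))

  G-0∷d∷ : ∀ K w → G (2 + K) (0 ∷ d ∷ w) ≡ G K w -ᶻ + d *ᶻ Dᶻ (suc K)
  G-0∷d∷ K w = identity (Dᶻ (2 + K)) (+ d) (Dᶻ (suc K)) (G K w)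
    where
    identity : ∀ X d D g → + 0 *ᶻ X +ᶻ + 1 -ᶻ (d *ᶻ D +ᶻ + 1 -ᶻ g) ≡ g -ᶻ d *ᶻ D
    identity = solve-∀

  lo-0∷d∷ : ∀ K t → lo K +ᶻ + t -ᶻ + d *ᶻ Dᶻ (suc K) ≡ lo (2 + K) +ᶻ + t
  lo-0∷d∷ K t = subst (λ L → lo K +ᶻ + t -ᶻ + d *ᶻ Dᶻ (suc K) ≡ + 1 -ᶻ L +ᶻ + t) (sym (Dᶻ-rec K))
                      (identity (Dᶻ K) (+ t) (+ d) (Dᶻ (suc K)))
    where
    identity : ∀ D₀ t d D₁ → + 1 -ᶻ D₀ +ᶻ t -ᶻ d *ᶻ D₁ ≡ + 1 -ᶻ (d *ᶻ D₁ +ᶻ D₀) +ᶻ t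
    identity = solve-∀

  inWindow? : ∀ K z → Dec (InWindow K z)
  inWindow? K z with z -ᶻ lo K in offset
  ... | -[1+ n ] = no λ (t , _ , z≡) →
    -[1+n]≢+ (trans (sym offset) (trans (cong (_-ᶻ lo K) z≡) (a+i-a≡i (lo K) (+ t))))
    where
    -[1+n]≢+ : ∀ {t} → -[1+ n ] ≢ + t
    -[1+n]≢+ ()
  ... | + t with t ℕP.<? D d (suc K)
  ...   | yes t<D = yes (t , t<D , trans (sym (a+[i-a]≡i (lo K) z)) (cong (lo K +ᶻ_) offset))
  ...   | no t≮D = no λ (u , u<D , z≡) →
    t≮D (subst (_< D d (suc K))
               (ℤP.+-injective (trans (sym (a+i-a≡i (lo K) (+ u))) (trans (cong (_-ᶻ lo K) (sym z≡)) offset))) u<D)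

  G-0∷ : ∀ K q → G (suc K) (0 ∷ q) ≡ + 1 -ᶻ G K q
  G-0∷ K q = identity (Dᶻ (suc K)) (G K q)
    where
    identity : ∀ X g → + 0 *ᶻ X +ᶻ + 1 -ᶻ g ≡ + 1 -ᶻ g
    identity = solve-∀

  G-zeros : ∀ K → G K (replicate K 0) ≡ [even] K
  G-zeros zero = refl
  G-zeros (suc K) = trans (G-0∷ K (replicate K 0)) (cong (+ 1 -ᶻ_) (G-zeros K))

module Rows (d : ℕ) where

  open Windows d

  valFrom-rec : ∀ k w → valFrom d (2 + k) w ≡ d * valFrom d (suc k) w + valFrom d k w
  valFrom-rec k [] = sym (cong (_+ 0) (ℕP.*-zeroʳ d))
  valFrom-rec k (x ∷ w) = begin
      x * (d * D d (suc k) + D d k) + valFrom d (3 + k) w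
    ≡⟨ cong (λ v → x * (d * D d (suc k) + D d k) + v) (valFrom-rec (suc k) w) ⟩
      x * (d * D d (suc k) + D d k) + (d * valFrom d (2 + k) w + valFrom d (suc k) w)
    ≡⟨ identity x d (D d (suc k)) (D d k) (valFrom d (2 + k) w) (valFrom d (suc k) w) ⟩
      d * (x * D d (suc k) + valFrom d (2 + k) w) + (x * D d k + valFrom d (suc k) w)
    ∎
    where
    open ≡-Reasoning
    identity : ∀ x d a b u v → x * (d * a + b) + (d * u + v) ≡ d * (x * a + u) + (x * b + v)
    identity = ℕRing.solve-∀

  valFrom-++-zeros : ∀ k w j → valFrom d k (w ++ replicate j 0) ≡ valFrom d k w
  valFrom-++-zeros k [] zero = refl
  valFrom-++-zeros k [] (suc j) = valFrom-++-zeros (suc k) [] j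
  valFrom-++-zeros k (x ∷ w) j = cong (λ v → x * D d k + v) (valFrom-++-zeros (suc k) w j)

  vᶻ : ℕ → Word → ℤ
  vᶻ k w = + valFrom d k w

  vᶻ-∷ : ∀ k x w → vᶻ k (x ∷ w) ≡ + x *ᶻ Dᶻ k +ᶻ vᶻ (suc k) w
  vᶻ-∷ k x w = trans (ℤP.pos-+ (x * D d k) _) (cong (_+ᶻ vᶻ (suc k) w) (ℤP.pos-* x (D d k)))

  vᶻ-rec : ∀ k w → vᶻ (2 + k) w ≡ + d *ᶻ vᶻ (suc k) w +ᶻ vᶻ k w
  vᶻ-rec k w = trans (cong +_ (valFrom-rec k w))
                     (trans (ℤP.pos-+ (d * valFrom d (suc k) w) _) (cong (_+ᶻ vᶻ k w) (ℤP.pos-* d _)))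

  -- ε k · C w k is the entry A(1 − k) of the row of w: both satisfy the row recurrence
  -- and they agree at k = 0 and k = 1.
  C : Word → ℕ → ℤ
  C w k = vᶻ 1 w *ᶻ Dᶻ (suc k) -ᶻ vᶻ 2 w *ᶻ Dᶻ k

  C-rec : ∀ w k → C w (2 + k) ≡ + d *ᶻ C w (suc k) +ᶻ C w k
  C-rec w k = trans (cong₂ (λ a b → vᶻ 1 w *ᶻ a -ᶻ vᶻ 2 w *ᶻ b) (Dᶻ-rec (suc k)) (Dᶻ-rec k))
                    (identity (vᶻ 1 w) (vᶻ 2 w) (+ d) (Dᶻ (2 + k)) (Dᶻ (suc k)) (Dᶻ k))
    where
    identity : ∀ v₁ v₂ d a b c → v₁ *ᶻ (d *ᶻ a +ᶻ b) -ᶻ v₂ *ᶻ (d *ᶻ b +ᶻ c)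
                               ≡ d *ᶻ (v₁ *ᶻ a -ᶻ v₂ *ᶻ b) +ᶻ (v₁ *ᶻ b -ᶻ v₂ *ᶻ c)
    identity = solve-∀

  back≡εC : ∀ w k → back d w (suc k) ≡ (ε (suc k) *ᶻ C w (suc k) , ε k *ᶻ C w k)
  back≡εC w zero =
    cong₂ _,_ (trans (identity₁ (vᶻ 1 w) (vᶻ 2 w) (+ d))
                     (cong (λ D₂ → (- + 1) *ᶻ (vᶻ 1 w *ᶻ D₂ -ᶻ vᶻ 2 w *ᶻ + 1)) (sym (Dᶻ-rec 0))))
              (identity₀ (vᶻ 1 w) (vᶻ 2 w))
    where
    identity₁ : ∀ v₁ v₂ d → v₂ -ᶻ d *ᶻ v₁ ≡ (- + 1) *ᶻ (v₁ *ᶻ (d *ᶻ + 1 +ᶻ + 0) -ᶻ v₂ *ᶻ + 1)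
    identity₁ = solve-∀
    identity₀ : ∀ v₁ v₂ → v₁ ≡ + 1 *ᶻ (v₁ *ᶻ + 1 -ᶻ v₂ *ᶻ + 0)
    identity₀ = solve-∀
  back≡εC w (suc k) = begin
      back d w (2 + k)
    ≡⟨ cong (λ b → proj₂ b -ᶻ + d *ᶻ proj₁ b , proj₁ b) (back≡εC w k) ⟩
      (ε k *ᶻ C w k -ᶻ + d *ᶻ (ε (suc k) *ᶻ C w (suc k)) , ε (suc k) *ᶻ C w (suc k))
    ≡⟨ cong (_, ε (suc k) *ᶻ C w (suc k)) (sym εC-rec) ⟩
      (ε (2 + k) *ᶻ C w (2 + k) , ε (suc k) *ᶻ C w (suc k))
    ∎
    where
    open ≡-Reasoning
    identity : ∀ s d c₁ c₀ → (- - s) *ᶻ (d *ᶻ c₁ +ᶻ c₀) ≡ s *ᶻ c₀ -ᶻ d *ᶻ ((- s) *ᶻ c₁)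
    identity = solve-∀
    εC-rec : ε (2 + k) *ᶻ C w (2 + k) ≡ ε k *ᶻ C w k -ᶻ + d *ᶻ (ε (suc k) *ᶻ C w (suc k))
    εC-rec = trans (cong (ε (2 + k) *ᶻ_) (C-rec w k)) (identity (ε k) (+ d) (C w (suc k)) (C w k))

  A≡εC : ∀ w K → A d w (- (+ K)) ≡ ε (suc K) *ᶻ C w (suc K)
  A≡εC w zero = cong proj₁ (back≡εC w 0)
  A≡εC w (suc K) = cong proj₁ (back≡εC w (suc K))

  C-∷ : ∀ x w K → C (x ∷ w) (2 + K) ≡ + x *ᶻ Dᶻ (suc K) -ᶻ C w (suc K)
  C-∷ x w K = begin
      vᶻ 1 (x ∷ w) *ᶻ Dᶻ (3 + K) -ᶻ vᶻ 2 (x ∷ w) *ᶻ Dᶻ (2 + K)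
    ≡⟨ cong₂ (λ a b → a *ᶻ Dᶻ (3 + K) -ᶻ b *ᶻ Dᶻ (2 + K)) (vᶻ-∷ 1 x w) (vᶻ-∷ 2 x w) ⟩
      (+ x *ᶻ + 1 +ᶻ vᶻ 2 w) *ᶻ Dᶻ (3 + K) -ᶻ (+ x *ᶻ Dᶻ 2 +ᶻ vᶻ 3 w) *ᶻ Dᶻ (2 + K)
    ≡⟨ cong₂ (λ a b → (+ x *ᶻ + 1 +ᶻ vᶻ 2 w) *ᶻ a -ᶻ b *ᶻ Dᶻ (2 + K))
             (Dᶻ-rec (suc K)) (cong₂ (λ D₂ v₃ → + x *ᶻ D₂ +ᶻ v₃) (Dᶻ-rec 0) (vᶻ-rec 1 w)) ⟩
      (+ x *ᶻ + 1 +ᶻ vᶻ 2 w) *ᶻ (+ d *ᶻ Dᶻ (2 + K) +ᶻ Dᶻ (suc K))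
        -ᶻ (+ x *ᶻ (+ d *ᶻ + 1 +ᶻ + 0) +ᶻ (+ d *ᶻ vᶻ 2 w +ᶻ vᶻ 1 w)) *ᶻ Dᶻ (2 + K)
    ≡⟨ identity (+ x) (+ d) (vᶻ 1 w) (vᶻ 2 w) (Dᶻ (2 + K)) (Dᶻ (suc K)) ⟩
      + x *ᶻ Dᶻ (suc K) -ᶻ C w (suc K)
    ∎
    where
    open ≡-Reasoning
    identity : ∀ x d v₁ v₂ a b → (x *ᶻ + 1 +ᶻ v₂) *ᶻ (d *ᶻ a +ᶻ b) -ᶻ (x *ᶻ (d *ᶻ + 1 +ᶻ + 0) +ᶻ (d *ᶻ v₂ +ᶻ v₁)) *ᶻ a
                               ≡ x *ᶻ b -ᶻ (v₁ *ᶻ a -ᶻ v₂ *ᶻ b)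
    identity = solve-∀

  C≡G-[even] : ∀ {K} p → length p ≡ K → C p (suc K) ≡ G K p -ᶻ [even] K
  C≡G-[even] [] refl = identity (Dᶻ 2)
    where
    identity : ∀ D₂ → + 0 *ᶻ D₂ -ᶻ + 0 *ᶻ + 1 ≡ + 1 -ᶻ + 1
    identity = solve-∀
  C≡G-[even] (x ∷ p) refl = begin
      C (x ∷ p) (2 + length p)
    ≡⟨ C-∷ x p (length p) ⟩
      + x *ᶻ Dᶻ (suc (length p)) -ᶻ C p (suc (length p))
    ≡⟨ cong (+ x *ᶻ Dᶻ (suc (length p)) -ᶻ_) (C≡G-[even] p refl) ⟩
      + x *ᶻ Dᶻ (suc (length p)) -ᶻ (G (length p) p -ᶻ [even] (length p))
    ≡⟨ identity (+ x *ᶻ Dᶻ (suc (length p))) (G (length p) p) ([even] (length p)) ⟩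
      G (suc (length p)) (x ∷ p) -ᶻ [even] (suc (length p))
    ∎
    where
    open ≡-Reasoning
    identity : ∀ a g e → a -ᶻ (g -ᶻ e) ≡ a +ᶻ + 1 -ᶻ g -ᶻ (+ 1 -ᶻ e)
    identity = solve-∀

  pad : ℕ → Word → Word
  pad K w = w ++ replicate (K ∸ length w) 0

  length-pad : ∀ {K} w → length w ≤ K → length (pad K w) ≡ K
  length-pad {K} w le = trans (ListP.length-++ w)
    (trans (cong (λ n → length w + n) (ListP.length-replicate (K ∸ length w))) (ℕP.m+[n∸m]≡n le))

  A-left : ∀ w K → length w ≤ K → A d w (- (+ K)) ≡ ε (suc K) *ᶻ (G K (pad K w) -ᶻ [even] K)
  A-left w K le =
    trans (A≡εC w K) (cong (ε (suc K) *ᶻ_) (trans (sym C-pad) (C≡G-[even] (pad K w) (length-pad w le))))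
    where
    C-pad : C (pad K w) (suc K) ≡ C w (suc K)
    C-pad = cong₂ (λ v₁ v₂ → + v₁ *ᶻ Dᶻ (2 + K) -ᶻ + v₂ *ᶻ Dᶻ (suc K))
                  (valFrom-++-zeros 1 w _) (valFrom-++-zeros 2 w _)

module OstrowskiArray (d : ℕ) (2≤d : 2 ≤ d) where

  open Windows d
  open Rows d

  0<d : 0 < d
  0<d = ℕP.<-≤-trans (s≤s z≤n) 2≤d

  record WindowBijection (K : ℕ) : Set where
    field
      into      : ∀ {p} → OfLength K p → InWindow K (G K p)
      injective : ∀ {p q} → OfLength K p → OfLength K q → G K p ≡ G K q → p ≡ q
      onto      : ∀ {t} → t < D d (suc K) → Σ Word λ p → OfLength K p × G K p ≡ lo K +ᶻ + t
  open WindowBijection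

  windowBijection₀ : WindowBijection 0
  windowBijection₀ = record { into = into₀ ; injective = injective₀ ; onto = onto₀ }
    where
    into₀ : ∀ {p} → OfLength 0 p → InWindow 0 (G 0 p)
    into₀ {[]} _ = 0 , s≤s z≤n , refl
    injective₀ : ∀ {p q} → OfLength 0 p → OfLength 0 q → G 0 p ≡ G 0 q → p ≡ q
    injective₀ {[]} {[]} _ _ _ = refl
    onto₀ : ∀ {t} → t < 1 → Σ Word λ p → OfLength 0 p × G 0 p ≡ lo 0 +ᶻ + t
    onto₀ (s≤s z≤n) = [] , ([] , refl) , refl

  windowBijection₁ : WindowBijection 1
  windowBijection₁ = record { into = into₁ ; injective = injective₁ ; onto = onto₁ }
    where
    D₂≡d : D d 2 ≡ d
    D₂≡d = trans (ℕP.+-identityʳ (d * 1)) (ℕP.*-identityʳ d)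
    G₁≡ : ∀ x → G 1 (x ∷ []) ≡ lo 1 +ᶻ + x
    G₁≡ x = identity (+ x)
      where
      identity : ∀ x → x *ᶻ + 1 +ᶻ + 1 -ᶻ + 1 ≡ + 1 -ᶻ + 1 +ᶻ x
      identity = solve-∀
    into₁ : ∀ {p} → OfLength 1 p → InWindow 1 (G 1 p)
    into₁ {x ∷ []} (x<d ∷ _ , _) = x , subst (x <_) (sym D₂≡d) x<d , G₁≡ x
    injective₁ : ∀ {p q} → OfLength 1 p → OfLength 1 q → G 1 p ≡ G 1 q → p ≡ q
    injective₁ {x ∷ []} {y ∷ []} _ _ eq =
      cong (_∷ []) (window-offset-injective 1 (trans (sym (G₁≡ x)) (trans eq (G₁≡ y))))
    onto₁ : ∀ {t} → t < D d 2 → Σ Word λ p → OfLength 1 p × G 1 p ≡ lo 1 +ᶻ + t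
    onto₁ {t} t<D₂ = t ∷ [] , (subst (t <_) D₂≡d t<D₂ ∷ [] , refl) , G₁≡ t

  -- The window of length K + 2 has D_{K+3} = D_{K+1} + d·D_{K+2} points: words 0d·w fill
  -- the first D_{K+1} of them as w runs through the window of length K, and words x·w
  -- with x < d fill the rest, x giving the block of D_{K+2} points and w (reversed) the
  -- position inside it.
  module Step (K : ℕ) (ih₀ : WindowBijection K) (ih₁ : WindowBijection (suc K)) where

    instance
      D-nonZero : NonZero (D d (2 + K))
      D-nonZero = >-nonZero (ℕP.<-≤-trans (s≤s z≤n) (n≤D 2≤d (2 + K)))

    digit-window : ∀ x {w} → OfLength (suc K) w → Σ ℕ λ t → Σ ℕ λ r →
                   t + suc r ≡ D d (2 + K) × r < D d (2 + K) × G (suc K) w ≡ lo (suc K) +ᶻ + t ×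
                   G (2 + K) (x ∷ w) ≡ lo (2 + K) +ᶻ + (D d (suc K) + (r + x * D d (2 + K)))
    digit-window x {w} ow with into ih₁ ow
    ... | t , t<D , eq with complement t<D
    ...   | r , r<D , split = t , r , split , r<D , eq , G-digit K x w t r split eq

    zero-d-window : ∀ w {t} → G K w ≡ lo K +ᶻ + t → G (2 + K) (0 ∷ d ∷ w) ≡ lo (2 + K) +ᶻ + t
    zero-d-window w {t} eq = trans (G-0∷d∷ K w) (trans (cong (_-ᶻ + d *ᶻ Dᶻ (suc K)) eq) (lo-0∷d∷ K t))

    digit≢zero-d : ∀ x {w v} → OfLength (suc K) w → OfLength K v → G (2 + K) (x ∷ w) ≢ G (2 + K) (0 ∷ d ∷ v)
    digit≢zero-d x {v = v} ow ov eq with digit-window x ow | into ih₀ ov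
    ... | _ , r , _ , _ , _ , eqx | t , t<D , eqv =
      ℕP.<-irrefl refl (ℕP.≤-<-trans (subst (D d (suc K) ≤_) offsets≡ (ℕP.m≤m+n (D d (suc K)) _)) t<D)
      where
      offsets≡ : D d (suc K) + (r + x * D d (2 + K)) ≡ t
      offsets≡ = window-offset-injective (2 + K) (trans (sym eqx) (trans eq (zero-d-window v eqv)))

    into₂ : ∀ {p} → OfLength (2 + K) p → InWindow (2 + K) (G (2 + K) p)
    into₂ {p} (op , len) with leadingDigits 0<d p op len
    ... | digit {x} x<d ow lw with digit-window x (ow , lw)
    ...   | _ , r , _ , r<D , _ , eq =
      _ , ℕP.<-≤-trans (ℕP.+-monoʳ-< (D d (suc K)) (r+q*n<d*n x<d r<D))
                       (ℕP.≤-reflexive (ℕP.+-comm (D d (suc K)) (d * D d (2 + K)))) , eq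
    into₂ {p} (op , len) | zero-d {w} ow lw with into ih₀ (ow , ℕP.suc-injective lw)
    ...   | t , t<D , eq = t , ℕP.<-≤-trans t<D (ℕP.m≤n+m _ _) , zero-d-window w eq

    digits-injective : ∀ {x y w v} → OfLength (suc K) w → OfLength (suc K) v →
                       G (2 + K) (x ∷ w) ≡ G (2 + K) (y ∷ v) → x ∷ w ≡ y ∷ v
    digits-injective {x} {y} ow ov eq with digit-window x ow | digit-window y ov
    ... | t , r , split , r<D , eqw , eqx | u , s , split′ , s<D , eqv , eqy =
      cong₂ _∷_ (proj₁ x≡y×r≡s) (injective ih₁ ow ov (trans eqw (trans (cong (λ z → lo (suc K) +ᶻ + z) t≡u) (sym eqv))))
      where
      x≡y×r≡s : x ≡ y × r ≡ s
      x≡y×r≡s = quotient-remainder-unique r<D s<D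
        (ℕP.+-cancelˡ-≡ (D d (suc K)) _ _ (window-offset-injective (2 + K) (trans (sym eqx) (trans eq eqy))))
      t≡u : t ≡ u
      t≡u = ℕP.+-cancelʳ-≡ (suc r) t u (trans split (trans (sym split′) (cong (λ z → u + suc z) (sym (proj₂ x≡y×r≡s)))))

    injective₂ : ∀ {p q} → OfLength (2 + K) p → OfLength (2 + K) q → G (2 + K) p ≡ G (2 + K) q → p ≡ q
    injective₂ {p} {q} (op , lp) (oq , lq) eq with leadingDigits 0<d p op lp | leadingDigits 0<d q oq lq
    ... | digit _ ow lw | digit _ ov lv = digits-injective (ow , lw) (ov , lv) eq
    ... | digit {x} _ ow lw | zero-d ov lv = ⊥-elim (digit≢zero-d x (ow , lw) (ov , ℕP.suc-injective lv) eq)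
    ... | zero-d ow lw | digit {y} _ ov lv = ⊥-elim (digit≢zero-d y (ov , lv) (ow , ℕP.suc-injective lw) (sym eq))
    ... | zero-d {w} ow lw | zero-d {v} ov lv =
      cong (λ u → 0 ∷ d ∷ u) (injective ih₀ (ow , ℕP.suc-injective lw) (ov , ℕP.suc-injective lv)
        (∙-cancelʳ (- (+ d *ᶻ Dᶻ (suc K))) _ _ (trans (sym (G-0∷d∷ K w)) (trans eq (G-0∷d∷ K v)))))

    digit-onto : ∀ s → s < d * D d (2 + K) →
                 Σ Word λ p → OfLength (2 + K) p × G (2 + K) p ≡ lo (2 + K) +ᶻ + (D d (suc K) + s)
    digit-onto s s<dD with complement (m%n<n s (D d (2 + K)))
    ... | t , t<D , split with onto ih₁ t<D
    ...   | w , (ow , lw) , eq =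
      s / D d (2 + K) ∷ w , (m<n*o⇒m/o<n s<dD ∷ ostrowski⇒ostrTail 0<d ow , cong suc lw) ,
      trans (G-digit K (s / D d (2 + K)) w t (s % D d (2 + K))
                     (trans (ℕP.+-comm t _) (trans (sym (ℕP.+-suc (s % D d (2 + K)) t)) split)) eq)
            (cong (λ z → lo (2 + K) +ᶻ + (D d (suc K) + z)) (sym (m≡m%n+[m/n]*n s (D d (2 + K)))))

    onto₂ : ∀ {t} → t < D d (3 + K) → Σ Word λ p → OfLength (2 + K) p × G (2 + K) p ≡ lo (2 + K) +ᶻ + t
    onto₂ {t} t<D with t ℕP.<? D d (suc K)
    ... | yes t<D₁ with onto ih₀ t<D₁
    ...   | w , (ow , lw) , eq = 0 ∷ d ∷ w , (0∷d∷-ostrowski 0<d ow , cong (λ n → 2 + n) lw) , zero-d-window w eq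
    onto₂ {t} t<D | no t≮D₁ =
      subst (λ z → Σ Word λ p → OfLength (2 + K) p × G (2 + K) p ≡ lo (2 + K) +ᶻ + z) D₁+[t∸D₁]≡t
            (digit-onto (t ∸ D d (suc K)) (ℕP.+-cancelˡ-< (D d (suc K)) _ _ t<D₁+dD))
      where
      D₁+[t∸D₁]≡t : D d (suc K) + (t ∸ D d (suc K)) ≡ t
      D₁+[t∸D₁]≡t = ℕP.m+[n∸m]≡n (ℕP.≮⇒≥ t≮D₁)
      t<D₁+dD : D d (suc K) + (t ∸ D d (suc K)) < D d (suc K) + d * D d (2 + K)
      t<D₁+dD = subst₂ _<_ (sym D₁+[t∸D₁]≡t) (ℕP.+-comm _ (D d (suc K))) t<D

    windowBijection₂ : WindowBijection (2 + K)
    windowBijection₂ = record { into = into₂ ; injective = injective₂ ; onto = onto₂ }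

  windowBijection : ∀ K → WindowBijection K
  windowBijection K = proj₁ (consecutive K)
    where
    consecutive : ∀ K → WindowBijection K × WindowBijection (suc K)
    consecutive zero = windowBijection₀ , windowBijection₁
    consecutive (suc K) with consecutive K
    ... | ih₀ , ih₁ = ih₁ , Step.windowBijection₂ K ih₀ ih₁

  inWindow-small : ∀ K a → ∣ a ∣ < D d (suc K) → InWindow (suc K) (a +ᶻ [even] (suc K))
  inWindow-small K a small with ∣i∣<u⇒i≡1-u+t a (D d (suc K)) small | [even]-bit (suc K)
  ... | t , t<2D , refl | b , b≤1 , e≡b = t + b , bound , eq
    where
    bound : t + b < D d (2 + K)
    bound = ℕP.≤-<-trans (ℕP.+-monoʳ-≤ t b≤1) (ℕP.<-≤-trans (subst (_< 2 * D d (suc K)) (ℕP.+-comm 1 t) t<2D) (D-double 2≤d K))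
    eq : lo (suc K) +ᶻ + t +ᶻ [even] (suc K) ≡ lo (suc K) +ᶻ + (t + b)
    eq = trans (cong (lo (suc K) +ᶻ + t +ᶻ_) e≡b)
               (trans (ℤP.+-assoc (lo (suc K)) (+ t) (+ b)) (cong (lo (suc K) +ᶻ_) (sym (ℤP.pos-+ t b))))

  trimmed-++-zeros≢0∷ : ∀ {w q} j → Trimmed d w → Ostrowski d q → w ++ replicate j 0 ≢ 0 ∷ q
  trimmed-++-zeros≢0∷ {[]} j (_ , () , _)
  trimmed-++-zeros≢0∷ {y ∷ v} j (_ , _ , not-0∷) oq eq =
    not-0∷ v (cong (_∷ v) (ListP.∷-injectiveˡ eq))
             (ostrowski-++⁻ˡ 0<d v (subst (Ostrowski d) (sym (ListP.∷-injectiveʳ eq)) oq))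

  module Occurrence (N : ℤ) where

    target : ℕ → ℤ
    target K = ε (suc K) *ᶻ N +ᶻ [even] K

    target-suc : ∀ K → target (suc K) ≡ + 1 -ᶻ target K
    target-suc K = identity (ε (suc K)) N ([even] K)
      where
      identity : ∀ s n e → (- s) *ᶻ n +ᶻ (+ 1 -ᶻ e) ≡ + 1 -ᶻ (s *ᶻ n +ᶻ e)
      identity = solve-∀

    RepresentedAt : ℕ → Set
    RepresentedAt K = Σ Word λ p → OfLength K p × G K p ≡ target K

    G-0∷≡target : ∀ K q → G K q ≡ target K → G (suc K) (0 ∷ q) ≡ target (suc K)
    G-0∷≡target K q eq = trans (G-0∷ K q) (trans (cong (+ 1 -ᶻ_) eq) (sym (target-suc K)))

    G-0∷≡target⁻¹ : ∀ K q → G (suc K) (0 ∷ q) ≡ target (suc K) → G K q ≡ target K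
    G-0∷≡target⁻¹ K q eq = ℤP.neg-injective (∙-cancelˡ (+ 1) _ _ (trans (sym (G-0∷ K q)) (trans eq (target-suc K))))

    representedAt-suc : ∀ {K} → RepresentedAt K → RepresentedAt (suc K)
    representedAt-suc {K} (p , (op , lp) , eq) = 0 ∷ p , (0∷-ostrowski 0<d op , cong suc lp) , G-0∷≡target K p eq

    representedAt-mono : ∀ {j K} → j ≤ K → RepresentedAt j → RepresentedAt K
    representedAt-mono j≤K = climb (ℕP.≤⇒≤′ j≤K)
      where
      climb : ∀ {j K} → j ≤′ K → RepresentedAt j → RepresentedAt K
      climb ≤′-refl r = r
      climb (≤′-step j≤′K) r = representedAt-suc (climb j≤′K r)

    inWindow⇒representedAt : ∀ {K} → InWindow K (target K) → RepresentedAt K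
    inWindow⇒representedAt {K} (t , t<D , eq) with onto (windowBijection K) t<D
    ... | p , op , eqp = p , op , trans eqp (sym eq)

    representedAt? : ∀ K → Dec (RepresentedAt K)
    representedAt? K = map′ inWindow⇒representedAt
                            (λ (p , op , eq) → subst (InWindow K) eq (into (windowBijection K) op))
                            (inWindow? K (target K))

    representedAt-large : RepresentedAt (suc ∣ N ∣)
    representedAt-large = inWindow⇒representedAt (inWindow-small ∣ N ∣ (ε (2 + ∣ N ∣) *ᶻ N) small)
      where
      small : ∣ ε (2 + ∣ N ∣) *ᶻ N ∣ < D d (suc ∣ N ∣)
      small = subst (_< D d (suc ∣ N ∣)) (sym (∣ε*i∣≡∣i∣ (2 + ∣ N ∣) N)) (n≤D 2≤d (suc ∣ N ∣))

    least-representedAt : ∀ K → RepresentedAt K → Σ ℕ λ K′ → RepresentedAt K′ × (∀ j → j < K′ → ¬ RepresentedAt j)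
    least-representedAt zero r = zero , r , λ _ ()
    least-representedAt (suc K) r with representedAt? K
    ... | yes rK = least-representedAt K rK
    ... | no ¬rK = suc K , r , λ j j<1+K rj → ¬rK (representedAt-mono (ℕP.≤-pred j<1+K) rj)

    OccursAt : Word → ℕ → Set
    OccursAt w K = Trimmed d w × length w ≤ K × A d w (- (+ K)) ≡ N

    A≡N⇒G≡target : ∀ {w K} → length w ≤ K → A d w (- (+ K)) ≡ N → G K (pad K w) ≡ target K
    A≡N⇒G≡target {w} {K} le eq = s*[g-e]≡n⇒g≡s*n+e {ε (suc K)} (ε²≡1 (suc K)) (trans (sym (A-left w K le)) eq)

    G≡target⇒A≡N : ∀ {w K} → length w ≤ K → G K (pad K w) ≡ target K → A d w (- (+ K)) ≡ N
    G≡target⇒A≡N {w} {K} le eq = trans (A-left w K le) (g≡s*n+e⇒s*[g-e]≡n {ε (suc K)} (ε²≡1 (suc K)) eq)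

    occurs⇒G-pad : ∀ {w K} → OccursAt w K → OfLength K (pad K w) × G K (pad K w) ≡ target K
    occurs⇒G-pad {w} ((ow , _) , le , eq) = (ostrowski-++-zeros 0<d _ ow , length-pad w le) , A≡N⇒G≡target le eq

    -- A representation q at K − 1 would make 0q a second representation at K.
    occurs⇒least : ∀ {w K} → OccursAt w K → ∀ j → j < K → ¬ RepresentedAt j
    occurs⇒least {w} {suc K} occ@(tw , _) j (s≤s j≤K) rj =
      let q , (oq , lq) , eqq = representedAt-mono j≤K rj
          opad , eqpad = occurs⇒G-pad occ
      in trimmed-++-zeros≢0∷ _ tw oq (injective (windowBijection (suc K)) opad (0∷-ostrowski 0<d oq , cong suc lq)
           (trans eqpad (sym (G-0∷≡target K q eqq))))

    occurs-≤ : ∀ {w K w′ K′} → OccursAt w K → OccursAt w′ K′ → K ≤ K′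
    occurs-≤ {w′ = w′} {K′} occ occ′ = ℕP.≮⇒≥ λ K′<K → occurs⇒least occ K′ K′<K (pad K′ w′ , occurs⇒G-pad occ′)

    occurs-same-K-unique : ∀ {w w′ K} → OccursAt w K → OccursAt w′ K → w ≡ w′
    occurs-same-K-unique occ@((_ , lw , _) , _) occ′@((_ , lw′ , _) , _) =
      let opad , eq = occurs⇒G-pad occ
          opad′ , eq′ = occurs⇒G-pad occ′
      in ++-zeros-injective _ _ lw lw′ (injective (windowBijection _) opad opad′ (trans eq (sym eq′)))

    occurs-unique : ∀ {w K w′ K′} → OccursAt w K → OccursAt w′ K′ → w ≡ w′ × K ≡ K′
    occurs-unique {w′ = w′} occ occ′ =
      let K≡K′ = ℕP.≤-antisym (occurs-≤ occ occ′) (occurs-≤ occ′ occ)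
      in occurs-same-K-unique occ (subst (OccursAt w′) (sym K≡K′) occ′) , K≡K′

    least-occurrence : ∀ {K p} → OfLength K p → G K p ≡ target K → (∀ j → j < K → ¬ RepresentedAt j) →
                       TrailingZeros p → N ≢ + 0 → Σ Word λ w → OccursAt w K
    least-occurrence {K} (_ , lp) eq _ (zeros j) N≢0 = ⊥-elim (N≢0 N≡0)
      where
      [even]≡target : [even] K ≡ target K
      [even]≡target = trans (sym (G-zeros K))
        (subst (λ i → G K (replicate i 0) ≡ target K) (trans (sym (ListP.length-replicate j)) lp) eq)
      identity : ∀ s e → s *ᶻ (e -ᶻ e) ≡ + 0
      identity = solve-∀
      N≡0 : N ≡ + 0
      N≡0 = trans (sym (g≡s*n+e⇒s*[g-e]≡n {ε (suc K)} (ε²≡1 (suc K)) [even]≡target))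
                  (identity (ε (suc K)) ([even] K))
    least-occurrence {K} (op , lp) eq least (nonzeros {w} lw j) _ =
      w , (ostrowski-++⁻ˡ 0<d w op , lw , not-0∷) , le ,
      G≡target⇒A≡N le (subst (λ i → G K (w ++ replicate i 0) ≡ target K) (sym K∸|w|≡j) eq)
      where
      |w|+j≡K : length w + j ≡ K
      |w|+j≡K = trans (sym (trans (ListP.length-++ w) (cong (λ n → length w + n) (ListP.length-replicate j)))) lp
      le : length w ≤ K
      le = subst (length w ≤_) |w|+j≡K (ℕP.m≤m+n _ j)
      K∸|w|≡j : K ∸ length w ≡ j
      K∸|w|≡j = trans (cong (_∸ length w) (sym |w|+j≡K)) (ℕP.m+n∸m≡n (length w) j)
      -- Stripping the leading 0 would represent N at K − 1, below the least K.
      not-0∷ : ∀ v → w ≡ 0 ∷ v → ¬ Ostrowski d v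
      not-0∷ v w≡0∷v ov = least _ (subst (length q <_) K≡ ℕP.≤-refl)
                                  (q , (ostrowski-++-zeros 0<d j ov , refl) , G-0∷≡target⁻¹ (length q) q eq′)
        where
        q : Word
        q = v ++ replicate j 0
        K≡ : suc (length q) ≡ K
        K≡ = trans (cong (λ u → length (u ++ replicate j 0)) (sym w≡0∷v)) lp
        eq′ : G (suc (length q)) (0 ∷ q) ≡ target (suc (length q))
        eq′ = subst (λ k → G k (0 ∷ q) ≡ target k) (sym K≡)
                    (subst (λ u → G K (u ++ replicate j 0) ≡ target K) w≡0∷v eq)

    occurs-somewhere : N ≢ + 0 → Σ Word λ w → Σ ℕ λ K → OccursAt w K
    occurs-somewhere N≢0 =
      let K , (p , op , eq) , least = least-representedAt _ representedAt-large
          w , occ = least-occurrence op eq least (trailingZeros p) N≢0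
      in w , K , occ

lemma2 : (d : ℕ) → 2 ≤ d → (N : ℤ) → N ≢ + 0 →
    Σ ℕ λ m → Σ ℤ λ n → Σ Word λ w →
      (IsW d m w × n ≤ℤ - (+ length w) × A d w n ≡ N)
      × (∀ m′ n′ w′ → IsW d m′ w′ → n′ ≤ℤ - (+ length w′) → A d w′ n′ ≡ N →
           (m′ ≡ m × n′ ≡ n))
lemma2 d 2≤d N N≢0 =
  let w , K , occ@(tw , |w|≤K , A≡N) = occurs-somewhere N≢0
      m , isW = rank-exists 2≤d tw
      unique : ∀ m′ n′ w′ → IsW d m′ w′ → n′ ≤ℤ - (+ length w′) → A d w′ n′ ≡ N →
               m′ ≡ m × n′ ≡ - (+ K)
      unique m′ n′ w′ isW′ n′≤ A′≡N =
        let K′ , |w′|≤K′ , n′≡ = ≤-[-k]⇒≡-[K] n′ (length w′) n′≤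
            occ′ = proj₁ (proj₂ isW′) , |w′|≤K′ , subst (λ n → A d w′ n ≡ N) n′≡ A′≡N
            w′≡w , K′≡K = occurs-unique occ′ occ
        in rank-unique (subst (IsW d m′) w′≡w isW′) isW , trans n′≡ (cong (λ k → - (+ k)) K′≡K)
  in m , - (+ K) , w , (isW , ℤP.neg-mono-≤ (+≤+ |w|≤K) , A≡N) , unique
  where
  open OstrowskiArray d 2≤d
  open Occurrence N
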